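{- Let $a,b,c\in\mathbb{N}$ with $a\le b\le c$, $3a=b+c$, $b>a$, and let $y=2(b-a)-1$, $z=2(c-a)-1$, where $z\ge 5$. Define three lists of length $2a-1=y+z+1$, each the concatenation of a block of length $z-1$ and a block of length $y+2$: First list: block 1 is each of $1,2,\dots,(z-1)/2$ twice in increasing order; block 2 is each of $(z+1)/2,\dots,a-1$ twice in increasing order, followed by $a$. Second list: block 1 is $1$, followed by each of $2,\dots,(z-1)/2$ twice in increasing order, followed by $1$; block 2 is $(z+1)/2,(z+1)/2+1,\dots,b-1$ (each once), followed by $(z+1)/2$. Third list: block 1 is $1,2,\dots,z-1$ (each once); block 2 is $z$, followed by each of $z+1,\dots,c-1$ twice in increasing order. For $k\in[2a-1]$ let $q_k$ be the triple whose entries are the $k$-th entries of the three lists. Then $Q=\{q_1,\dots,q_{2a-1}\}$ is a feasible strategy for $(a,b,c)$-Mastermind.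
   Context: $[n]=\{1,\dots,n\}$. In $(a,b,c)$-Mastermind, secrets and questions are triples in $[a]\times[b]\times[c]$. $g(s,q)$ is the number of $k\in[3]$ with $s_k=q_k$. A strategy is a set $Q$ of questions; it is feasible if for all distinct secrets $s,s'$ there is $q\in Q$ with $g(s,q)\neq g(s',q)$. -}

module Defs where

open import Data.Nat using (ℕ; zero; suc; _+_; _*_; _∸_; _≤_; _≡ᵇ_; _/_)
open import Data.Bool using (if_then_else_)
open import Data.List using (List; []; _∷_; _++_; map; upTo; concatMap; zipWith)
open import Data.List.Membership.Propositional using (_∈_)
open import Data.Product using (_×_; _,_; Σ-syntax)
open import Relation.Binary.PropositionalEquality using (_≢_)

Triple : Set
Triple = ℕ × ℕ × ℕ

InBox : ℕ → ℕ → ℕ → Triple → Set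
InBox a b c (s₁ , s₂ , s₃) = (1 ≤ s₁ × s₁ ≤ a) × (1 ≤ s₂ × s₂ ≤ b) × (1 ≤ s₃ × s₃ ≤ c)

δ : ℕ → ℕ → ℕ
δ m n = if m ≡ᵇ n then 1 else 0

g : Triple → Triple → ℕ
g (s₁ , s₂ , s₃) (q₁ , q₂ , q₃) = δ s₁ q₁ + δ s₂ q₂ + δ s₃ q₃

IsStrategy : ℕ → ℕ → ℕ → List Triple → Set
IsStrategy a b c Q = ∀ q → q ∈ Q → InBox a b c q

Distinguishes : ℕ → ℕ → ℕ → List Triple → Set
Distinguishes a b c Q =
  ∀ s s′ → InBox a b c s → InBox a b c s′ → s ≢ s′ →
  Σ[ q ∈ Triple ] (q ∈ Q × g s q ≢ g s′ q)

FeasibleStrategy : ℕ → ℕ → ℕ → List Triple → Set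
FeasibleStrategy a b c Q = IsStrategy a b c Q × Distinguishes a b c Q

-- range m n = m , m+1 , … , n   (empty if n < m)
range : ℕ → ℕ → List ℕ
range m n = map (m +_) (upTo (suc n ∸ m))

twice : List ℕ → List ℕ
twice = concatMap (λ x → x ∷ x ∷ [])

-- z = 2(c-a)-1   (y = 2(b-a)-1 only enters through the block lengths)
zOf : ℕ → ℕ → ℕ
zOf a c = 2 * (c ∸ a) ∸ 1

list₁ : ℕ → ℕ → ℕ → List ℕ
list₁ a b c =
  twice (range 1 ((zOf a c ∸ 1) / 2))
  ++ (twice (range ((zOf a c + 1) / 2) (a ∸ 1)) ++ (a ∷ []))

list₂ : ℕ → ℕ → ℕ → List ℕ
list₂ a b c =
  (1 ∷ twice (range 2 ((zOf a c ∸ 1) / 2)) ++ (1 ∷ []))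
  ++ (range ((zOf a c + 1) / 2) (b ∸ 1) ++ ((zOf a c + 1) / 2 ∷ []))

list₃ : ℕ → ℕ → ℕ → List ℕ
list₃ a b c =
  range 1 (zOf a c ∸ 1)
  ++ (zOf a c ∷ twice (range (zOf a c + 1) (c ∸ 1)))

questions : ℕ → ℕ → ℕ → List Triple
questions a b c = zipWith _,_ (list₁ a b c) (zipWith _,_ (list₂ a b c) (list₃ a b c))

module Submission where

-- Put m = (z - 1) / 2 ≥ 2 and E = b - a ≥ 1, so that a = m + E + 1,
-- b = a + E and c = a + m + 1.  The answer to a question is a sum of three
-- indicators, one per coordinate, and the questions sharing a value in a given
-- coordinate form a "fibre" of at most two questions.  The first 2m questions
-- form a cycle in which neighbours alternately share their first and their second
-- entry; the last 2E + 1 form an odd cycle in which neighbours alternately share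
-- their first and their third entry, closed up by sharing the second one.  If two
-- secrets agree in one coordinate, the other two coordinates are recovered because
-- no fibre of one coordinate is a fibre of another.  If they differ in every
-- coordinate yet get the same answers, then every answer is at most 1, so each
-- fibre of one secret is covered exactly by fibres of the other, and following
-- these covers along the two cycles always ends in a contradiction.

open import Defs

open import Data.Bool using (Bool; true; false; if_then_else_)
import Data.Bool.Properties as Bool
open import Data.Empty using (⊥; ⊥-elim)
open import Data.Fin using (Fin; zero; suc; fromℕ; fromℕ<; inject₁; toℕ; combine; _↑ˡ_; _↑ʳ_)
import Data.Fin.Properties as Fin
open import Data.Fin.Relation.Unary.Top using (view; ‵fromℕ; ‵inject₁)
open import Data.List using (List; []; _∷_; _++_; length; zipWith; applyUpTo; upTo)
open import Data.List.Membership.Propositional using (_∈_; find; lose)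
open import Data.List.Properties using (length-map; length-upTo; map-applyUpTo; length-++)
open import Data.List.Relation.Unary.All using (All; []; _∷_)
import Data.List.Relation.Unary.All as All
import Data.List.Relation.Unary.All.Properties as All
open import Data.List.Relation.Unary.Any using (here; there; any?)
open import Data.Nat using (ℕ; zero; suc; _+_; _*_; _∸_; _/_; _≤_; _<_; z≤n; s≤s)
open import Data.Nat.DivMod using (m*n/n≡m)
import Data.Nat.Properties as ℕ
open import Data.Nat.Tactic.RingSolver using (solve-∀)
open import Data.Product using (_×_; _,_; ∃; proj₁; proj₂)
open import Data.Product.Function.NonDependent.Propositional using (_×-↔_)
import Data.Product.Properties as ×
open import Data.Sum using (_⊎_; inj₁; inj₂)
open import Data.Sum.Function.Propositional using (_⊎-↔_)
import Data.Sum.Properties as ⊎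
open import Data.Unit using (⊤; tt)
import Data.Unit.Properties as ⊤
open import Function using (_∘_; id)
open import Function.Bundles using (Inverse; _↔_)
open import Function.Construct.Composition using (_↔-∘_)
open import Function.Construct.Identity using (↔-id)
open import Function.Construct.Symmetry using (↔-sym)
open import Relation.Binary.Definitions using (DecidableEquality)
open import Relation.Binary.PropositionalEquality
open import Relation.Nullary using (Dec; yes; no; does; ¬_; ¬?; contradiction)
open import Relation.Nullary.Decidable using (decidable-stable)

-- Indicators and fibres

χ : ∀ {p} {P : Set p} → Dec P → ℕ
χ d = if does d then 1 else 0

χ-cong : ∀ {P Q : Set} (p? : Dec P) (q? : Dec Q) → (P → Q) → (Q → P) → χ p? ≡ χ q?
χ-cong (yes _) (yes _) _ _ = refl
χ-cong (no _) (no _) _ _ = refl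
χ-cong (yes p) (no ¬q) p→q _ = contradiction (p→q p) ¬q
χ-cong (no ¬p) (yes q) _ q→p = contradiction (q→p q) ¬p

χ≡1 : ∀ {A : Set} {x y : A} (x≟y : Dec (x ≡ y)) → x ≡ y → χ x≟y ≡ 1
χ≡1 (yes _) _ = refl
χ≡1 (no x≢y) x≡y = contradiction x≡y x≢y

χ-disjoint : ∀ {A : Set} (_≟_ : DecidableEquality A) {a a' x : A} → a ≢ a' → χ (a ≟ x) + χ (a' ≟ x) ≤ 1
χ-disjoint _≟_ {a} {a'} {x} a≢a' with a ≟ x | a' ≟ x
... | yes a≡x | yes a'≡x = contradiction (trans a≡x (sym a'≡x)) a≢a'
... | yes _   | no _     = s≤s z≤n
... | no _    | yes _    = s≤s z≤n
... | no _    | no _     = z≤n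

OntoExcept : {T A : Set} → (T → A) → A → Set
OntoExcept f a₀ = ∀ a → a ≢ a₀ → ∃ λ t → a ≡ f t

NoCommonFibre : {T A B : Set} → (T → A) → (T → B) → Set
NoCommonFibre f h = ∀ t₀ → ∃ λ t → (f t ≡ f t₀ × h t ≢ h t₀) ⊎ (f t ≢ f t₀ × h t ≡ h t₀)

module _ {T A : Set} (_≟_ : DecidableEquality A) {f : T → A} {a₀ : A} (onto : OntoExcept f a₀) where

  private
    hit-differs : ∀ {a a' t} → a ≢ a' → a ≡ f t → χ (a ≟ f t) ≢ χ (a' ≟ f t)
    hit-differs {a} {a'} {t} a≢a' a≡ft with a ≟ f t | a' ≟ f t
    ... | no a≢ft | _         = contradiction a≡ft a≢ft
    ... | yes _   | yes a'≡ft = contradiction (trans a≡ft (sym a'≡ft)) a≢a'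
    ... | yes _   | no _      = λ ()

  fibre-injective : ∀ {a a'} → (∀ t → χ (a ≟ f t) ≡ χ (a' ≟ f t)) → a ≡ a'
  fibre-injective {a} {a'} agree with a ≟ a' | a ≟ a₀
  ... | yes a≡a' | _ = a≡a'
  ... | no a≢a' | no a≢a₀ =
    let t , a≡ft = onto a a≢a₀ in contradiction (agree t) (hit-differs a≢a' a≡ft)
  ... | no a≢a' | yes refl =
    let t , a'≡ft = onto a' (a≢a' ∘ sym) in contradiction (sym (agree t)) (hit-differs (a≢a' ∘ sym) a'≡ft)

module _ {T A B : Set} (_≟A_ : DecidableEquality A) (_≟B_ : DecidableEquality B)
         {f : T → A} {h : T → B} {a₀ : A} {b₀ : B}
         (f-onto : OntoExcept f a₀) (h-onto : OntoExcept h b₀) (separated : NoCommonFibre f h) where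

  private
    module _ {a b a' b'} (agree : ∀ t → χ (a ≟A f t) + χ (b ≟B h t) ≡ χ (a' ≟A f t) + χ (b' ≟B h t))
             (a≢a' : a ≢ a') where

      fibre-of-a⊆fibre-of-b' : ∀ t → a ≡ f t → b' ≡ h t × b ≢ h t
      fibre-of-a⊆fibre-of-b' t a≡ft with a ≟A f t | a' ≟A f t | b ≟B h t | b' ≟B h t | agree t
      ... | no a≢ft | _         | _       | _         | _ = contradiction a≡ft a≢ft
      ... | yes _   | yes a'≡ft | _       | _         | _ = contradiction (trans a≡ft (sym a'≡ft)) a≢a'
      ... | yes _   | no _      | no b≢ht | yes b'≡ht | _ = b'≡ht , b≢ht
      ... | yes _   | no _      | yes _   | yes _     | ()
      ... | yes _   | no _      | yes _   | no _      | ()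
      ... | yes _   | no _      | no _    | no _      | ()

      fibre-of-b'⊆fibre-of-a : b ≢ b' → ∀ t → b' ≡ h t → a ≡ f t
      fibre-of-b'⊆fibre-of-a b≢b' t b'≡ht with a ≟A f t | a' ≟A f t | b ≟B h t | b' ≟B h t | agree t
      ... | yes a≡ft | _     | _       | _        | _ = a≡ft
      ... | no _     | _     | _       | no b'≢ht | _ = contradiction b'≡ht b'≢ht
      ... | no _     | _     | yes b≡ht | yes _   | _ = contradiction (trans b≡ht (sym b'≡ht)) b≢b'
      ... | no _     | yes _ | no _    | yes _    | ()
      ... | no _     | no _  | no _    | yes _    | ()

      a-unattained : ∀ {t₁} → a ≢ f t₁
      a-unattained {t₁} a≡ft₁ with fibre-of-a⊆fibre-of-b' t₁ a≡ft₁ | separated t₁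
      ... | b'≡ht₁ , b≢ht₁ | t , inj₁ (ft≡ft₁ , ht≢ht₁) =
        ht≢ht₁ (trans (sym (proj₁ (fibre-of-a⊆fibre-of-b' t (trans a≡ft₁ (sym ft≡ft₁))))) b'≡ht₁)
      ... | b'≡ht₁ , b≢ht₁ | t , inj₂ (ft≢ft₁ , ht≡ht₁) =
        ft≢ft₁ (trans (sym (fibre-of-b'⊆fibre-of-a (λ b≡b' → b≢ht₁ (trans b≡b' b'≡ht₁)) t (trans b'≡ht₁ (sym ht≡ht₁)))) a≡ft₁)

  fibre-sum-injective : ∀ {a b a' b'} →
    (∀ t → χ (a ≟A f t) + χ (b ≟B h t) ≡ χ (a' ≟A f t) + χ (b' ≟B h t)) → a ≡ a' × b ≡ b'
  fibre-sum-injective {a} {b} {a'} {b'} agree with a ≟A a' | a ≟A a₀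
  ... | yes refl | _ = refl , fibre-injective _≟B_ h-onto (λ t → ℕ.+-cancelˡ-≡ (χ (a ≟A f t)) _ _ (agree t))
  ... | no a≢a' | no a≢a₀ = let _ , a≡ft = f-onto a a≢a₀ in ⊥-elim (a-unattained agree a≢a' a≡ft)
  ... | no a≢a' | yes refl =
    let _ , a'≡ft = f-onto a' (a≢a' ∘ sym) in ⊥-elim (a-unattained (sym ∘ agree) (a≢a' ∘ sym) a'≡ft)

-- Answers to three-coordinate questions

x+x≤3⇒x≤1 : ∀ x → x + x ≤ 3 → x ≤ 1
x+x≤3⇒x≤1 zero _ = z≤n
x+x≤3⇒x≤1 (suc zero) _ = s≤s z≤n
x+x≤3⇒x≤1 (suc (suc x)) (s≤s (s≤s x+2+x≤1)) with ℕ.m+n≤o⇒n≤o x x+2+x≤1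
... | s≤s ()

cancel-first : ∀ x {y z y' z'} → x + y + z ≡ x + y' + z' → y + z ≡ y' + z'
cancel-first x {y} {z} {y'} {z'} eq =
  ℕ.+-cancelˡ-≡ x _ _ (trans (sym (ℕ.+-assoc x y z)) (trans eq (ℕ.+-assoc x y' z')))

cancel-middle : ∀ x y z x' z' → x + y + z ≡ x' + y + z' → x + z ≡ x' + z'
cancel-middle x y z x' z' eq = cancel-first y (trans (swap₁₂ y x z) (trans eq (sym (swap₁₂ y x' z'))))
  where
  swap₁₂ : ∀ y x z → y + x + z ≡ x + y + z
  swap₁₂ = solve-∀

module Answers {Q U V W : Set}
  (_≟U_ : DecidableEquality U) (_≟V_ : DecidableEquality V) (_≟W_ : DecidableEquality W)
  (qu : Q → U) (qv : Q → V) (qw : Q → W) where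

  Secret : Set
  Secret = U × V × W

  answer : Secret → Q → ℕ
  answer (u , v , w) t = χ (u ≟U qu t) + χ (v ≟V qv t) + χ (w ≟W qw t)

  _≈_ : Secret → Secret → Set
  s ≈ s' = ∀ t → answer s t ≡ answer s' t

  data Hit : Secret → Q → Set where
    byU : ∀ {u v w t} → u ≡ qu t → Hit (u , v , w) t
    byV : ∀ {u v w t} → v ≡ qv t → Hit (u , v , w) t
    byW : ∀ {u v w t} → w ≡ qw t → Hit (u , v , w) t

  hit-transfer : ∀ {s s' t} → s ≈ s' → Hit s t → Hit s' t
  hit-transfer {t = t} agree hit = positive⇒hit (subst (1 ≤_) (agree t) (hit⇒positive hit))
    where
    hit⇒positive : ∀ {s} → Hit s t → 1 ≤ answer s t
    hit⇒positive {u , v , w} hit with u ≟U qu t | v ≟V qv t | w ≟W qw t | hit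
    ... | yes _ | _     | _     | _      = s≤s z≤n
    ... | no _  | yes _ | _     | _      = s≤s z≤n
    ... | no _  | no _  | yes _ | _      = s≤s z≤n
    ... | no u≢ | no _  | no _  | byU eq = contradiction eq u≢
    ... | no _  | no v≢ | no _  | byV eq = contradiction eq v≢
    ... | no _  | no _  | no w≢ | byW eq = contradiction eq w≢

    positive⇒hit : ∀ {s} → 1 ≤ answer s t → Hit s t
    positive⇒hit {u , v , w} positive with u ≟U qu t | v ≟V qv t | w ≟W qw t
    ... | yes eq | _      | _      = byU eq
    ... | no _   | yes eq | _      = byV eq
    ... | no _   | no _   | yes eq = byW eq
    ... | no _   | no _   | no _   with positive
    ...   | ()

  record Confusion (s s' : Secret) : Set where
    field
      u≢u' : proj₁ s ≢ proj₁ s'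
      v≢v' : proj₁ (proj₂ s) ≢ proj₁ (proj₂ s')
      w≢w' : proj₂ (proj₂ s) ≢ proj₂ (proj₂ s')
      agree : s ≈ s'

  swap : ∀ {s s'} → Confusion s s' → Confusion s' s
  swap c = record { u≢u' = u≢u' ∘ sym ; v≢v' = v≢v' ∘ sym ; w≢w' = w≢w' ∘ sym ; agree = sym ∘ agree }
    where open Confusion c

  answer-≤1 : ∀ {s s'} → Confusion s s' → ∀ t → answer s t ≤ 1
  answer-≤1 {u , v , w} {u' , v' , w'} c t = x+x≤3⇒x≤1 (answer (u , v , w) t) (begin
    answer (u , v , w) t + answer (u , v , w) t     ≡⟨ cong (answer (u , v , w) t +_) (agree t) ⟩
    answer (u , v , w) t + answer (u' , v' , w') t  ≡⟨ regroup (χ (u ≟U qu t)) (χ (v ≟V qv t)) (χ (w ≟W qw t)) _ _ _ ⟩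
    (χ (u ≟U qu t) + χ (u' ≟U qu t)) + (χ (v ≟V qv t) + χ (v' ≟V qv t)) + (χ (w ≟W qw t) + χ (w' ≟W qw t))
      ≤⟨ ℕ.+-mono-≤ (ℕ.+-mono-≤ (χ-disjoint _≟U_ u≢u') (χ-disjoint _≟V_ v≢v')) (χ-disjoint _≟W_ w≢w') ⟩
    3                                               ∎)
    where
    open Confusion c
    open ℕ.≤-Reasoning
    regroup : ∀ x y z x' y' z' → x + y + z + (x' + y' + z') ≡ (x + x') + (y + y') + (z + z')
    regroup = solve-∀

  unique-hit-UV : ∀ {u v w s' t} → Confusion (u , v , w) s' → u ≡ qu t → v ≡ qv t → ⊥
  unique-hit-UV {u} {v} {t = t} c u≡ v≡ with answer-≤1 c t
  ... | ≤1 rewrite χ≡1 (u ≟U qu t) u≡ | χ≡1 (v ≟V qv t) v≡ with ≤1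
  ...   | s≤s ()

  unique-hit-UW : ∀ {u v w s' t} → Confusion (u , v , w) s' → u ≡ qu t → w ≡ qw t → ⊥
  unique-hit-UW {u} {v} {w} {t = t} c u≡ w≡ with answer-≤1 c t
  ... | ≤1 rewrite χ≡1 (u ≟U qu t) u≡ | χ≡1 (w ≟W qw t) w≡ with ≤1
  ...   | s≤s v+1≤0 with ℕ.m+n≤o⇒n≤o (χ (v ≟V qv t)) v+1≤0
  ...     | ()

  module _ {u₀ : U} {v₀ : V} {w₀ : W}
           (qu-onto : OntoExcept qu u₀) (qv-onto : OntoExcept qv v₀) (qw-onto : OntoExcept qw w₀)
           (uv-separated : NoCommonFibre qu qv) (uw-separated : NoCommonFibre qu qw)
           (vw-separated : NoCommonFibre qv qw)
           (no-confusion : ∀ {s s'} → ¬ Confusion s s') where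

    answers-injective : ∀ {s s'} → s ≈ s' → s ≡ s'
    answers-injective {u , v , w} {u' , v' , w'} agree with u ≟U u' | v ≟V v' | w ≟W w'
    ... | yes refl | _ | _
      with fibre-sum-injective _≟V_ _≟W_ qv-onto qw-onto vw-separated {v} {w} {v'} {w'}
             (λ t → cancel-first (χ (u ≟U qu t)) (agree t))
    ...   | refl , refl = refl
    answers-injective {u , v , w} {u' , v' , w'} agree | no _ | yes refl | _
      with fibre-sum-injective _≟U_ _≟W_ qu-onto qw-onto uw-separated {u} {w} {u'} {w'}
             (λ t → cancel-middle (χ (u ≟U qu t)) (χ (v ≟V qv t)) (χ (w ≟W qw t)) (χ (u' ≟U qu t)) (χ (w' ≟W qw t))
                                  (agree t))
    ...   | refl , refl = refl
    answers-injective {u , v , w} {u' , v' , w'} agree | no _ | no _ | yes refl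
      with fibre-sum-injective _≟U_ _≟V_ qu-onto qv-onto uv-separated {u} {v} {u'} {v'}
             (λ t → ℕ.+-cancelʳ-≡ (χ (w ≟W qw t)) _ _ (agree t))
    ...   | refl , refl = refl
    answers-injective agree | no u≢u' | no v≢v' | no w≢w' =
      ⊥-elim (no-confusion record { u≢u' = u≢u' ; v≢v' = v≢v' ; w≢w' = w≢w' ; agree = agree })

-- The questions as an abstract configuration

prev : ∀ {k} → Fin (suc k) → Fin (suc k)
prev {k} zero = fromℕ k
prev (suc j) = inject₁ j

inject₁≢suc : ∀ {k} (j : Fin k) → inject₁ j ≢ suc j
inject₁≢suc zero ()
inject₁≢suc (suc j) eq = inject₁≢suc j (Fin.suc-injective eq)

prev≢ : ∀ {k} (j : Fin (suc (suc k))) → prev j ≢ j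
prev≢ zero ()
prev≢ (suc j) = inject₁≢suc j

prev-surjective : ∀ {k} (i : Fin (suc k)) → ∃ λ j → prev j ≡ i
prev-surjective i with view i
... | ‵fromℕ = zero , refl
... | ‵inject₁ j = suc j , refl

-- With m = n + 2 and E = e + 1, the numbering in `Numbering` sends ua i, ub k, ul to
-- i + 1, m + 1 + k, a; va i, vb k bit, vn to i + 1, m + 1 + 2k + bit, b; and wa i bit,
-- wb t, wn to 2i + 1 + bit, 2m + 1 + t, c (false/true read as 0/1).  The questions
-- a₀ i, a₁ j, b₀ k, b₁ k, ℓ sit at the (0-based) positions 2i, 2 (prev j) + 1,
-- 2m + 2k, 2m + 2k + 1 and 2m + 2E of the lists.
module Model (n e : ℕ) where

  U V W : Set
  U = Fin (2 + n) ⊎ Fin (suc e) ⊎ ⊤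
  V = Fin (2 + n) ⊎ (Fin (suc e) × Bool) ⊎ ⊤
  W = (Fin (2 + n) × Bool) ⊎ Fin (2 + e) ⊎ ⊤

  pattern ua i = inj₁ i
  pattern ub k = inj₂ (inj₁ k)
  pattern ul = inj₂ (inj₂ tt)
  pattern va i = inj₁ i
  pattern vb k bit = inj₂ (inj₁ (k , bit))
  pattern vn = inj₂ (inj₂ tt)
  pattern wa i bit = inj₁ (i , bit)
  pattern wb t = inj₂ (inj₁ t)
  pattern wn = inj₂ (inj₂ tt)

  _≟U_ : DecidableEquality U
  _≟U_ = ⊎.≡-dec Fin._≟_ (⊎.≡-dec Fin._≟_ ⊤._≟_)

  _≟V_ : DecidableEquality V
  _≟V_ = ⊎.≡-dec Fin._≟_ (⊎.≡-dec (×.≡-dec Fin._≟_ Bool._≟_) ⊤._≟_)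

  _≟W_ : DecidableEquality W
  _≟W_ = ⊎.≡-dec (×.≡-dec Fin._≟_ Bool._≟_) (⊎.≡-dec Fin._≟_ ⊤._≟_)

  data Question : Set where
    a₀ a₁ : Fin (2 + n) → Question
    b₀ b₁ : Fin (suc e) → Question
    ℓ : Question

  qu : Question → U
  qu (a₀ i) = ua i
  qu (a₁ j) = ua (prev j)
  qu (b₀ k) = ub k
  qu (b₁ k) = ub k
  qu ℓ = ul

  qv : Question → V
  qv (a₀ i) = va i
  qv (a₁ j) = va j
  qv (b₀ k) = vb k false
  qv (b₁ k) = vb k true
  qv ℓ = vb zero false

  qw : Question → W
  qw (a₀ i) = wa i false
  qw (a₁ j) = wa (prev j) true
  qw (b₀ k) = wb (inject₁ k)
  qw (b₁ k) = wb (suc k)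
  qw ℓ = wb (fromℕ (suc e))

  open Answers _≟U_ _≟V_ _≟W_ qu qv qw public

  ua-injective : ∀ {i j} → _≡_ {A = U} (ua i) (ua j) → i ≡ j
  ua-injective refl = refl

  ub-injective : ∀ {k k'} → _≡_ {A = U} (ub k) (ub k') → k ≡ k'
  ub-injective refl = refl

  va-injective : ∀ {i j} → _≡_ {A = V} (va i) (va j) → i ≡ j
  va-injective refl = refl

  vb-injective : ∀ {k k' bit bit'} → _≡_ {A = V} (vb k bit) (vb k' bit') → k ≡ k'
  vb-injective refl = refl

  wa-injective : ∀ {i j bit bit'} → _≡_ {A = W} (wa i bit) (wa j bit') → i ≡ j
  wa-injective refl = refl

  wb-injective : ∀ {t t'} → _≡_ {A = W} (wb t) (wb t') → t ≡ t'
  wb-injective refl = refl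

  qu-onto : OntoExcept qu ul
  qu-onto (ua i) _ = a₀ i , refl
  qu-onto (ub k) _ = b₀ k , refl
  qu-onto ul ul≢ul = contradiction refl ul≢ul

  qv-onto : OntoExcept qv vn
  qv-onto (va i) _ = a₀ i , refl
  qv-onto (vb k false) _ = b₀ k , refl
  qv-onto (vb k true) _ = b₁ k , refl
  qv-onto vn vn≢vn = contradiction refl vn≢vn

  qw-onto : OntoExcept qw wn
  qw-onto (wa i false) _ = a₀ i , refl
  qw-onto (wa i true) _ with prev-surjective i
  ... | j , refl = a₁ j , refl
  qw-onto (wb t) _ with view t
  ... | ‵fromℕ = ℓ , refl
  ... | ‵inject₁ k = b₀ k , refl
  qw-onto wn wn≢wn = contradiction refl wn≢wn

  uv-separated : NoCommonFibre qu qv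
  uv-separated (a₀ i) = a₁ i , inj₂ (prev≢ i ∘ ua-injective , refl)
  uv-separated (a₁ j) = a₀ j , inj₂ (prev≢ j ∘ sym ∘ ua-injective , refl)
  uv-separated (b₀ k) = b₁ k , inj₁ (refl , λ ())
  uv-separated (b₁ k) = b₀ k , inj₁ (refl , λ ())
  uv-separated ℓ = b₀ zero , inj₂ ((λ ()) , refl)

  uw-separated : NoCommonFibre qu qw
  uw-separated (a₀ i) with prev-surjective i
  ... | j , refl = a₁ j , inj₁ (refl , λ ())
  uw-separated (a₁ j) = a₀ (prev j) , inj₁ (refl , λ ())
  uw-separated (b₀ k) = b₁ k , inj₁ (refl , inject₁≢suc k ∘ sym ∘ wb-injective)
  uw-separated (b₁ k) = b₀ k , inj₁ (refl , inject₁≢suc k ∘ wb-injective)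
  uw-separated ℓ = b₁ (fromℕ e) , inj₂ ((λ ()) , refl)

  vw-separated : NoCommonFibre qv qw
  vw-separated (a₀ i) = a₁ i , inj₁ (refl , λ ())
  vw-separated (a₁ j) = a₀ j , inj₁ (refl , λ ())
  vw-separated (b₀ zero) = ℓ , inj₁ (refl , λ ())
  vw-separated (b₀ (suc k)) = b₁ (inject₁ k) , inj₂ ((λ ()) , refl)
  vw-separated (b₁ k) with view k
  ... | ‵fromℕ = ℓ , inj₂ ((λ ()) , refl)
  ... | ‵inject₁ k' = b₀ (suc k') , inj₂ ((λ ()) , refl)
  vw-separated ℓ = b₀ zero , inj₁ (refl , λ ())

  private
    transfer : ∀ {s s' t} → Confusion s s' → Hit s t → Hit s' t
    transfer c = hit-transfer (Confusion.agree c)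

  open Confusion

  -- In a confusion s' hits exactly the questions that s hits, and each secret hits
  -- each question at most once (answer-≤1).  So the fibre of u, missed by u', is
  -- covered by the fibres of v' and w'.  In cover-a and cover-b the first alternative
  -- continues this cover forwards along the cycle, the second one backwards.
  cover-a : ∀ {j v w u' v' w'} → Confusion (ua (prev j) , v , w) (u' , v' , w') →
    (v' ≡ va j × w' ≡ wa (prev j) false) ⊎ (v' ≡ va (prev j) × w' ≡ wa (prev j) true)
  cover-a {j} c with transfer c (byU {t = a₀ (prev j)} refl) | transfer c (byU {t = a₁ j} refl)
  ... | byU eq   | _        = contradiction (sym eq) (u≢u' c)
  ... | _        | byU eq   = contradiction (sym eq) (u≢u' c)
  ... | byV refl | byV eq   = contradiction (va-injective eq) (prev≢ j)
  ... | byW refl | byV refl = inj₁ (refl , refl)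
  ... | byV refl | byW refl = inj₂ (refl , refl)
  ... | byW refl | byW ()

  cover-b : ∀ {k v w u' v' w'} → Confusion (ub k , v , w) (u' , v' , w') →
    (v' ≡ vb k false × w' ≡ wb (suc k)) ⊎ (v' ≡ vb k true × w' ≡ wb (inject₁ k))
  cover-b {k} c with transfer c (byU {t = b₀ k} refl) | transfer c (byU {t = b₁ k} refl)
  ... | byU eq   | _        = contradiction (sym eq) (u≢u' c)
  ... | _        | byU eq   = contradiction (sym eq) (u≢u' c)
  ... | byV refl | byV ()
  ... | byV refl | byW refl = inj₁ (refl , refl)
  ... | byW refl | byV refl = inj₂ (refl , refl)
  ... | byW refl | byW eq   = contradiction (wb-injective eq) (inject₁≢suc k)

  cover-ℓ : ∀ {v w u' v' w'} → Confusion (ul , v , w) (u' , v' , w') →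
    v' ≡ vb zero false ⊎ w' ≡ wb (fromℕ (suc e))
  cover-ℓ c with transfer c (byU {t = ℓ} refl)
  ... | byU eq = contradiction (sym eq) (u≢u' c)
  ... | byV eq = inj₁ eq
  ... | byW eq = inj₂ eq

  private
    no-confusion-wa-ub : ∀ {u v i bit k v' w'} → ¬ Confusion (u , v , wa i bit) (ub k , v' , w')
    no-confusion-wa-ub c with cover-b (swap c)
    ... | inj₁ (_ , ())
    ... | inj₂ (_ , ())

    no-confusion-ul-va-wa : ∀ {u v w i j bit} → ¬ Confusion (u , v , w) (ul , va i , wa j bit)
    no-confusion-ul-va-wa c with cover-ℓ (swap c)
    ... | inj₁ refl with transfer c (byV {t = b₀ zero} refl)
    ...   | byU ()
    ...   | byV ()
    ...   | byW ()
    no-confusion-ul-va-wa c | inj₂ refl with transfer c (byW {t = b₁ (fromℕ e)} refl)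
    ...   | byU ()
    ...   | byV ()
    ...   | byW ()

    a-forward : ∀ {j v u'} → ¬ Confusion (ua (prev j) , v , wa j false) (u' , va j , wa (prev j) false)
    a-forward {j} {u' = ua i'} c with prev-surjective i'
    ... | j' , refl with cover-a {j'} (swap c)
    ...   | inj₁ (_ , eq) = unique-hit-UV {t = a₀ j} (swap c) (cong ua (sym (wa-injective eq))) refl
    ...   | inj₂ (_ , ())
    a-forward {u' = ub k} c = no-confusion-wa-ub c
    a-forward {u' = ul} c = no-confusion-ul-va-wa c

    a-backward : ∀ {j v u'} →
      ¬ Confusion (ua (prev j) , v , wa (prev (prev j)) true) (u' , va (prev j) , wa (prev j) true)
    a-backward {j} {u' = ua i'} c with prev-surjective i'
    ... | j' , refl with cover-a {j'} (swap c)
    ...   | inj₁ (_ , ())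
    ...   | inj₂ (_ , eq) = unique-hit-UV {t = a₁ (prev j)} (swap c) (cong ua (sym (wa-injective eq))) refl
    a-backward {u' = ub k} c = no-confusion-wa-ub c
    a-backward {u' = ul} c = no-confusion-ul-va-wa c

  no-confusion-a : ∀ {i v w u' v' w'} → ¬ Confusion (ua i , v , w) (u' , v' , w')
  no-confusion-a {i} c with prev-surjective i
  ... | j , refl with cover-a {j} c
  ...   | inj₁ (refl , refl) with transfer (swap c) (byV {t = a₀ j} refl)
  ...     | byU eq = contradiction (ua-injective eq) (prev≢ j)
  ...     | byV eq = contradiction eq (v≢v' c)
  ...     | byW refl = a-forward {j} c
  no-confusion-a c | j , refl | inj₂ (refl , refl) with transfer (swap c) (byV {t = a₁ (prev j)} refl)
  ...     | byU eq = contradiction (sym (ua-injective eq)) (prev≢ (prev j))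
  ...     | byV eq = contradiction eq (v≢v' c)
  ...     | byW refl = a-backward {j} c

  private
    b-forward-step : ∀ {κ k' w} →
      ¬ Confusion (ub (inject₁ κ) , vb k' false , w) (ub k' , vb (inject₁ κ) false , wb (suc (inject₁ κ)))
    b-forward-step {κ} c with transfer (swap c) (byW {t = b₀ (suc κ)} refl)
    ... | byU eq = contradiction (ub-injective eq) (inject₁≢suc κ)
    ... | byV eq = unique-hit-UW {t = b₀ (suc κ)} (swap c) (cong ub (vb-injective eq)) refl
    ... | byW eq = contradiction eq (w≢w' c)

    b-forward-forward : ∀ {k k'} → ¬ Confusion (ub k , vb k' false , wb (suc k')) (ub k' , vb k false , wb (suc k))
    b-forward-forward {k} {k'} c with view k | view k'
    ... | ‵inject₁ _ | _          = b-forward-step c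
    ... | ‵fromℕ     | ‵inject₁ _ = b-forward-step (swap c)
    ... | ‵fromℕ     | ‵fromℕ     = u≢u' c refl

    b-forward-backward : ∀ {k k'} →
      ¬ Confusion (ub k , vb k' true , wb (inject₁ k')) (ub k' , vb k false , wb (suc k))
    b-forward-backward {k} c with view k
    ... | ‵inject₁ κ with transfer (swap c) (byW {t = b₀ (suc κ)} refl)
    ...   | byU eq = contradiction (ub-injective eq) (inject₁≢suc κ)
    ...   | byV ()
    ...   | byW eq = contradiction eq (w≢w' c)
    b-forward-backward c | ‵fromℕ with transfer (swap c) (byW {t = ℓ} refl)
    ...   | byU ()
    ...   | byV ()
    ...   | byW eq = contradiction eq (w≢w' c)

    b-backward-step : ∀ {κ k'} →
      ¬ Confusion (ub (suc κ) , vb k' true , wb (inject₁ k')) (ub k' , vb (suc κ) true , wb (inject₁ (suc κ)))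
    b-backward-step {κ} c with transfer (swap c) (byW {t = b₁ (inject₁ κ)} refl)
    ... | byU eq = contradiction (sym (ub-injective eq)) (inject₁≢suc κ)
    ... | byV eq = unique-hit-UW {t = b₁ (inject₁ κ)} (swap c) (cong ub (vb-injective eq)) refl
    ... | byW eq = contradiction eq (w≢w' c)

    b-backward-backward : ∀ {k k'} →
      ¬ Confusion (ub k , vb k' true , wb (inject₁ k')) (ub k' , vb k true , wb (inject₁ k))
    b-backward-backward {suc _} c = b-backward-step c
    b-backward-backward {zero} {suc _} c = b-backward-step (swap c)
    b-backward-backward {zero} {zero} c = u≢u' c refl

  no-confusion-b : ∀ {k k' v w v' w'} → ¬ Confusion (ub k , v , w) (ub k' , v' , w')
  no-confusion-b c with cover-b c | cover-b (swap c)
  ... | inj₁ (refl , refl) | inj₁ (refl , refl) = b-forward-forward c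
  ... | inj₁ (refl , refl) | inj₂ (refl , refl) = b-forward-backward c
  ... | inj₂ (refl , refl) | inj₁ (refl , refl) = b-forward-backward (swap c)
  ... | inj₂ (refl , refl) | inj₂ (refl , refl) = b-backward-backward c

  no-confusion-ℓ : ∀ {k v w v' w'} → ¬ Confusion (ul , v , w) (ub k , v' , w')
  no-confusion-ℓ c with cover-ℓ c
  ... | inj₁ refl with transfer (swap c) (byV {t = b₀ zero} refl)
  ...   | byU ()
  ...   | byV eq = contradiction eq (v≢v' c)
  ...   | byW refl with cover-b (swap c)
  ...     | inj₁ (_ , ())
  ...     | inj₂ (_ , eq) =
    unique-hit-UV {t = b₀ zero} (swap c) (cong ub (Fin.inject₁-injective (sym (wb-injective eq)))) refl
  no-confusion-ℓ c | inj₂ refl with transfer (swap c) (byW {t = b₁ (fromℕ e)} refl)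
  ...   | byU ()
  ...   | byW eq = contradiction eq (w≢w' c)
  ...   | byV refl with cover-b (swap c)
  ...     | inj₁ (() , _)
  ...     | inj₂ (eq , _) = unique-hit-UW {t = b₁ (fromℕ e)} (swap c) (cong ub (sym (vb-injective eq))) refl

  no-confusion : ∀ {s s'} → ¬ Confusion s s'
  no-confusion {ua _ , _ , _} c = no-confusion-a c
  no-confusion {_} {ua _ , _ , _} c = no-confusion-a (swap c)
  no-confusion {ub _ , _ , _} {ub _ , _ , _} c = no-confusion-b c
  no-confusion {ub _ , _ , _} {ul , _ , _} c = no-confusion-ℓ (swap c)
  no-confusion {ul , _ , _} {ub _ , _ , _} c = no-confusion-ℓ c
  no-confusion {ul , _ , _} {ul , _ , _} c = u≢u' c refl

-- Numbering a finite type by an interval of ℕ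

module Encoding {X : Set} {N : ℕ} (X↔Fin : X ↔ Fin N) where
  open Inverse X↔Fin

  enc : X → ℕ
  enc x = suc (toℕ (to x))

  enc-injective : ∀ {x y} → enc x ≡ enc y → x ≡ y
  enc-injective {x} {y} eq = begin
    x             ≡⟨ strictlyInverseʳ x ⟨
    from (to x)   ≡⟨ cong from (Fin.toℕ-injective (ℕ.suc-injective eq)) ⟩
    from (to y)   ≡⟨ strictlyInverseʳ y ⟩
    y             ∎
    where open ≡-Reasoning

  enc-onto : ∀ {k} → 1 ≤ k → k ≤ N → ∃ λ x → enc x ≡ k
  enc-onto {suc k} _ k<N = from (fromℕ< k<N) , cong suc (begin
    toℕ (to (from (fromℕ< k<N)))  ≡⟨ cong toℕ (strictlyInverseˡ _) ⟩
    toℕ (fromℕ< k<N)             ≡⟨ Fin.toℕ-fromℕ< k<N ⟩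
    k                             ∎)
    where open ≡-Reasoning

  δ-enc : (_≟_ : DecidableEquality X) → ∀ x y → δ (enc x) (enc y) ≡ χ (x ≟ y)
  δ-enc _≟_ x y = χ-cong (enc x ℕ.≟ enc y) (x ≟ y) enc-injective (cong enc)

⊎↔Fin : ∀ {A B : Set} {p q} → A ↔ Fin p → B ↔ Fin q → (A ⊎ B) ↔ Fin (p + q)
⊎↔Fin A↔ B↔ = ↔-sym Fin.+↔⊎ ↔-∘ (A↔ ⊎-↔ B↔)

×↔Fin : ∀ {A B : Set} {p q} → A ↔ Fin p → B ↔ Fin q → (A × B) ↔ Fin (p * q)
×↔Fin A↔ B↔ = ↔-sym Fin.*↔× ↔-∘ (A↔ ×-↔ B↔)

distinguishes-via-encoding : ∀ {S Q : Set} {a b c} {questions : List Triple}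
  (answer : S → Q → ℕ) (encS : S → Triple) (encQ : Q → Triple) →
  (∀ {s} → InBox a b c s → ∃ λ σ → encS σ ≡ s) →
  (∀ σ t → g (encS σ) (encQ t) ≡ answer σ t) →
  (∀ t → encQ t ∈ questions) →
  (∀ {σ σ'} → (∀ t → answer σ t ≡ answer σ' t) → σ ≡ σ') →
  Distinguishes a b c questions
distinguishes-via-encoding {questions = questions} answer encS encQ decode g≡answer listed injective
  s s' s∈box s'∈box s≢s' with decode s∈box | decode s'∈box
... | σ , refl | σ' , refl with any? (λ q → ¬? (g (encS σ) q ℕ.≟ g (encS σ') q)) questions
...   | yes differs = find differs
...   | no ¬differs = contradiction (cong encS (injective same-answers)) s≢s'
  where
  same-answers : ∀ t → answer σ t ≡ answer σ' t
  same-answers t = begin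
    answer σ t            ≡⟨ g≡answer σ t ⟨
    g (encS σ) (encQ t)   ≡⟨ decidable-stable (_ ℕ.≟ _) (¬differs ∘ lose (listed t)) ⟩
    g (encS σ') (encQ t)  ≡⟨ g≡answer σ' t ⟩
    answer σ' t           ∎
    where open ≡-Reasoning

-- Indexing lists

-- Lookup with junk value 0 out of range, which makes !-twice-even, !-twice-odd and
-- !-∷-twice hold without bounds.
infixl 9 _!_
_!_ : List ℕ → ℕ → ℕ
[] ! _ = 0
(x ∷ _) ! zero = x
(_ ∷ xs) ! suc p = xs ! p

!-++ˡ : ∀ xs {ys p} → p < length xs → (xs ++ ys) ! p ≡ xs ! p
!-++ˡ (x ∷ xs) {p = zero} _ = refl
!-++ˡ (x ∷ xs) {p = suc p} (s≤s p<) = !-++ˡ xs p<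

!-++ʳ : ∀ xs {ys L} → length xs ≡ L → ∀ p → (xs ++ ys) ! (L + p) ≡ ys ! p
!-++ʳ [] refl p = refl
!-++ʳ (x ∷ xs) refl p = !-++ʳ xs refl p

!-++-∷ : ∀ xs {y ys L} → length xs ≡ L → (xs ++ y ∷ ys) ! L ≡ y
!-++-∷ [] refl = refl
!-++-∷ (x ∷ xs) refl = !-++-∷ xs refl

!-twice-even : ∀ xs p → twice xs ! (2 * p) ≡ xs ! p
!-twice-even [] p = refl
!-twice-even (x ∷ xs) zero = refl
!-twice-even (x ∷ xs) (suc p) = trans (cong (twice (x ∷ xs) !_) (ℕ.*-suc 2 p)) (!-twice-even xs p)

!-twice-odd : ∀ xs p → twice xs ! suc (2 * p) ≡ xs ! p
!-twice-odd [] p = refl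
!-twice-odd (x ∷ xs) zero = refl
!-twice-odd (x ∷ xs) (suc p) = trans (cong (λ q → twice (x ∷ xs) ! suc q) (ℕ.*-suc 2 p)) (!-twice-odd xs p)

!-∷-twice : ∀ x xs p → (x ∷ twice xs) ! (2 * p) ≡ (x ∷ xs) ! p
!-∷-twice x xs zero = refl
!-∷-twice x xs (suc p) = trans (cong ((x ∷ twice xs) !_) (ℕ.*-suc 2 p)) (!-twice-odd xs p)

!-applyUpTo : ∀ f {n p} → p < n → applyUpTo f n ! p ≡ f p
!-applyUpTo f {suc n} {zero} _ = refl
!-applyUpTo f {suc n} {suc p} (s≤s p<n) = !-applyUpTo (f ∘ suc) p<n

length-twice : ∀ xs → length (twice xs) ≡ 2 * length xs
length-twice [] = refl
length-twice (x ∷ xs) = trans (cong (2 +_) (length-twice xs)) (sym (ℕ.*-suc 2 (length xs)))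

length-range : ∀ lo {hi k} → suc hi ≡ lo + k → length (range lo hi) ≡ k
length-range lo {hi} {k} 1+hi≡lo+k = begin
  length (range lo hi)  ≡⟨ length-map (lo +_) (upTo (suc hi ∸ lo)) ⟩
  length (upTo (suc hi ∸ lo)) ≡⟨ length-upTo (suc hi ∸ lo) ⟩
  suc hi ∸ lo           ≡⟨ cong (_∸ lo) 1+hi≡lo+k ⟩
  lo + k ∸ lo           ≡⟨ ℕ.m+n∸m≡n lo k ⟩
  k                     ∎
  where open ≡-Reasoning

!-range : ∀ lo {hi k p} → suc hi ≡ lo + k → p < k → range lo hi ! p ≡ lo + p
!-range lo {hi} {k} 1+hi≡lo+k p<k rewrite map-applyUpTo id (lo +_) (suc hi ∸ lo) =
  !-applyUpTo (lo +_) (subst (_ <_) (sym (trans (cong (_∸ lo) 1+hi≡lo+k) (ℕ.m+n∸m≡n lo k))) p<k)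

∈-zip₃ : ∀ xs ys zs {p} → p < length xs → p < length ys → p < length zs →
  (xs ! p , ys ! p , zs ! p) ∈ zipWith _,_ xs (zipWith _,_ ys zs)
∈-zip₃ (x ∷ xs) (y ∷ ys) (z ∷ zs) {zero} _ _ _ = here refl
∈-zip₃ (x ∷ xs) (y ∷ ys) (z ∷ zs) {suc p} (s≤s p<) (s≤s q<) (s≤s r<) = there (∈-zip₃ xs ys zs p< q< r<)

∈-zip⁻ : ∀ {A B : Set} {x : A} {y : B} {xs ys} → (x , y) ∈ zipWith _,_ xs ys → x ∈ xs × y ∈ ys
∈-zip⁻ {xs = _ ∷ _} {_ ∷ _} (here refl) = here refl , here refl
∈-zip⁻ {xs = _ ∷ _} {_ ∷ _} (there xy∈) = let x∈ , y∈ = ∈-zip⁻ xy∈ in there x∈ , there y∈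

InRange : ℕ → ℕ → Set
InRange N x = 1 ≤ x × x ≤ N

all-in-range : ∀ {N} lo hi → 1 ≤ lo → hi ≤ N → All (InRange N) (range lo hi)
all-in-range lo hi 1≤lo hi≤N =
  All.map⁺ (All.applyUpTo⁺₁ id (suc hi ∸ lo) (λ i< → ℕ.≤-trans 1≤lo (ℕ.m≤m+n lo _) , ℕ.≤-trans (top lo hi i<) hi≤N))
  where
  top : ∀ lo hi {i} → i < suc hi ∸ lo → lo + i ≤ hi
  top zero hi (s≤s i≤hi) = i≤hi
  top (suc zero) zero ()
  top (suc (suc lo)) zero ()
  top (suc lo) (suc hi) i< = s≤s (top lo hi i<)

all-twice : ∀ {P : ℕ → Set} {xs} → All P xs → All P (twice xs)
all-twice [] = []
all-twice (px ∷ pxs) = px ∷ px ∷ all-twice pxs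

is-strategy-if-in-range : ∀ {a b c xs ys zs} → All (InRange a) xs → All (InRange b) ys → All (InRange c) zs →
  IsStrategy a b c (zipWith _,_ xs (zipWith _,_ ys zs))
is-strategy-if-in-range xs-in ys-in zs-in _ q∈ =
  let x∈ , yz∈ = ∈-zip⁻ q∈ ; y∈ , z∈ = ∈-zip⁻ yz∈ in All.lookup xs-in x∈ , All.lookup ys-in y∈ , All.lookup zs-in z∈

double-< : ∀ {i k} → i < k → 2 * i < 2 * k
double-< = ℕ.*-monoʳ-< 2

double-suc-< : ∀ {i k} → i < k → suc (2 * i) < 2 * k
double-suc-< {i} i<k = ℕ.≤-trans (ℕ.≤-reflexive (sym (ℕ.*-suc 2 i))) (ℕ.*-monoʳ-≤ 2 i<k)

-- The lists of the statement

module Numbering (n e : ℕ) where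
  open Model n e

  m E z : ℕ
  m = 2 + n
  E = suc e
  z = suc (2 * m)

  -- a, b and c are written as the sizes of U, V and W, so that the bijections below
  -- typecheck without casts.
  a b c : ℕ
  a = m + (E + 1)
  b = m + (E * 2 + 1)
  c = m * 2 + (suc E + 1)

  U↔Fin : U ↔ Fin a
  U↔Fin = ⊎↔Fin (↔-id _) (⊎↔Fin (↔-id _) (↔-sym Fin.1↔⊤))

  V↔Fin : V ↔ Fin b
  V↔Fin = ⊎↔Fin (↔-id _) (⊎↔Fin (×↔Fin (↔-id _) (↔-sym Fin.2↔Bool)) (↔-sym Fin.1↔⊤))

  W↔Fin : W ↔ Fin c
  W↔Fin = ⊎↔Fin (×↔Fin (↔-id _) (↔-sym Fin.2↔Bool)) (⊎↔Fin (↔-id _) (↔-sym Fin.1↔⊤))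

  open Encoding U↔Fin using () renaming (enc to encU; enc-onto to encU-onto; δ-enc to δ-encU)
  open Encoding V↔Fin using () renaming (enc to encV; enc-onto to encV-onto; δ-enc to δ-encV)
  open Encoding W↔Fin using () renaming (enc to encW; enc-onto to encW-onto; δ-enc to δ-encW)

  encU-ua : ∀ i → encU (ua i) ≡ suc (toℕ i)
  encU-ua i = cong suc (Fin.toℕ-↑ˡ i (E + 1))

  encU-ub : ∀ k → encU (ub k) ≡ suc m + toℕ k
  encU-ub k = cong suc (trans (Fin.toℕ-↑ʳ m (k ↑ˡ 1)) (cong (m +_) (Fin.toℕ-↑ˡ k 1)))

  encU-ul : encU ul ≡ a
  encU-ul = trans (cong suc (trans (Fin.toℕ-↑ʳ m (E ↑ʳ zero)) (cong (m +_) (Fin.toℕ-↑ʳ E zero)))) (regroup m E)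
    where
    regroup : ∀ m E → suc (m + (E + 0)) ≡ m + (E + 1)
    regroup = solve-∀

  encV-va : ∀ i → encV (va i) ≡ suc (toℕ i)
  encV-va i = cong suc (Fin.toℕ-↑ˡ i (E * 2 + 1))

  encV-vb-false : ∀ k → encV (vb k false) ≡ suc m + 2 * toℕ k
  encV-vb-false k = cong suc (trans (Fin.toℕ-↑ʳ m _) (cong (m +_)
    (trans (Fin.toℕ-↑ˡ (combine k zero) 1) (trans (Fin.toℕ-combine k zero) (ℕ.+-identityʳ _)))))

  encV-vb-true : ∀ k → encV (vb k true) ≡ suc m + suc (2 * toℕ k)
  encV-vb-true k = cong suc (trans (Fin.toℕ-↑ʳ m _) (cong (m +_)
    (trans (Fin.toℕ-↑ˡ (combine k (suc zero)) 1) (trans (Fin.toℕ-combine k (suc zero)) (ℕ.+-comm _ 1)))))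

  encW-wa-false : ∀ i → encW (wa i false) ≡ suc (2 * toℕ i)
  encW-wa-false i =
    cong suc (trans (Fin.toℕ-↑ˡ (combine i zero) _) (trans (Fin.toℕ-combine i zero) (ℕ.+-identityʳ _)))

  encW-wa-true : ∀ i → encW (wa i true) ≡ suc (suc (2 * toℕ i))
  encW-wa-true i =
    cong suc (trans (Fin.toℕ-↑ˡ (combine i (suc zero)) _) (trans (Fin.toℕ-combine i (suc zero)) (ℕ.+-comm _ 1)))

  encW-wb : ∀ t → encW (wb t) ≡ z + toℕ t
  encW-wb t = cong suc (trans (Fin.toℕ-↑ʳ (m * 2) (t ↑ˡ 1)) (cong₂ _+_ (ℕ.*-comm m 2) (Fin.toℕ-↑ˡ t 1)))

  zOf≡z : zOf a c ≡ z
  zOf≡z = begin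
    2 * (c ∸ a) ∸ 1          ≡⟨ cong (λ d → 2 * (d ∸ a) ∸ 1) (regroup m E) ⟩
    2 * (a + suc m ∸ a) ∸ 1  ≡⟨ cong (λ d → 2 * d ∸ 1) (ℕ.m+n∸m≡n a (suc m)) ⟩
    2 * suc m ∸ 1            ≡⟨ cong (_∸ 1) (ℕ.*-suc 2 m) ⟩
    z                        ∎
    where
    open ≡-Reasoning
    regroup : ∀ m E → m * 2 + (suc E + 1) ≡ m + (E + 1) + suc m
    regroup = solve-∀

  ⌊z/2⌋≡m : (zOf a c ∸ 1) / 2 ≡ m
  ⌊z/2⌋≡m = trans (cong (λ x → (x ∸ 1) / 2) zOf≡z) (trans (cong (_/ 2) (ℕ.*-comm 2 m)) (m*n/n≡m m 2))

  ⌈z/2⌉≡1+m : (zOf a c + 1) / 2 ≡ suc m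
  ⌈z/2⌉≡1+m = trans (cong (λ x → (x + 1) / 2) zOf≡z) (trans (cong (_/ 2) (regroup m)) (m*n/n≡m (suc m) 2))
    where
    regroup : ∀ m → suc (2 * m) + 1 ≡ suc m * 2
    regroup = solve-∀

  a≡1+m+E : a ≡ suc m + E
  a≡1+m+E = regroup m E
    where
    regroup : ∀ m E → m + (E + 1) ≡ suc m + E
    regroup = solve-∀

  b≡1+m+2E : b ≡ suc m + 2 * E
  b≡1+m+2E = regroup m E
    where
    regroup : ∀ m E → m + (E * 2 + 1) ≡ suc m + 2 * E
    regroup = solve-∀

  c≡z+1+E : c ≡ (z + 1) + E
  c≡z+1+E = regroup m E
    where
    regroup : ∀ m E → m * 2 + (suc E + 1) ≡ (suc (2 * m) + 1) + E
    regroup = solve-∀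

  R₁ S₁ R₂ S₂ R₃ S₃ X₂ L₁ L₂ L₃ : List ℕ
  R₁ = range 1 m
  S₁ = range (suc m) (a ∸ 1)
  R₂ = range 2 m
  S₂ = range (suc m) (b ∸ 1)
  R₃ = range 1 (2 * m)
  S₃ = range (z + 1) (c ∸ 1)
  X₂ = 1 ∷ twice R₂ ++ 1 ∷ []
  L₁ = twice R₁ ++ (twice S₁ ++ a ∷ [])
  L₂ = X₂ ++ (S₂ ++ suc m ∷ [])
  L₃ = R₃ ++ (z ∷ twice S₃)

  list₁≡L₁ : list₁ a b c ≡ L₁
  list₁≡L₁ rewrite ⌊z/2⌋≡m | ⌈z/2⌉≡1+m = refl

  list₂≡L₂ : list₂ a b c ≡ L₂
  list₂≡L₂ rewrite ⌊z/2⌋≡m | ⌈z/2⌉≡1+m = refl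

  list₃≡L₃ : list₃ a b c ≡ L₃
  list₃≡L₃ rewrite zOf≡z = refl

  length-twice-R₁ : length (twice R₁) ≡ 2 * m
  length-twice-R₁ = trans (length-twice R₁) (cong (2 *_) (length-range 1 {m} {m} refl))

  length-twice-R₂ : length (twice R₂) ≡ 2 * suc n
  length-twice-R₂ = trans (length-twice R₂) (cong (2 *_) (length-range 2 {m} {suc n} refl))

  length-X₂ : length X₂ ≡ 2 * m
  length-X₂ = trans (cong suc (trans (length-++ (twice R₂)) (cong (_+ 1) length-twice-R₂))) (regroup n)
    where
    regroup : ∀ n → suc (2 * suc n + 1) ≡ 2 * (2 + n)
    regroup = solve-∀

  length-R₃ : length R₃ ≡ 2 * m
  length-R₃ = length-range 1 {2 * m} {2 * m} refl

  length-twice-S₁ : length (twice S₁) ≡ 2 * E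
  length-twice-S₁ = trans (length-twice S₁) (cong (2 *_) (length-range (suc m) a≡1+m+E))

  length-S₂ : length S₂ ≡ 2 * E
  length-S₂ = length-range (suc m) b≡1+m+2E

  length-twice-S₃ : length (twice S₃) ≡ 2 * E
  length-twice-S₃ = trans (length-twice S₃) (cong (2 *_) (length-range (z + 1) c≡z+1+E))

  private
    !-first-block : ∀ xs {ys p} → length xs ≡ 2 * m → p < 2 * m → (xs ++ ys) ! p ≡ xs ! p
    !-first-block xs len p< = !-++ˡ xs (subst (_ <_) (sym len) p<)

    !-second-block : ∀ xs {ys} → length xs ≡ 2 * m → ∀ q → (xs ++ ys) ! (2 * m + q) ≡ ys ! q
    !-second-block xs = !-++ʳ xs

  L₁-a : ∀ {i} → i < m → L₁ ! (2 * i) ≡ suc i × L₁ ! suc (2 * i) ≡ suc i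
  L₁-a {i} i<m =
    trans (!-first-block (twice R₁) length-twice-R₁ (double-< i<m)) (trans (!-twice-even R₁ i) (!-range 1 refl i<m)) ,
    trans (!-first-block (twice R₁) length-twice-R₁ (double-suc-< i<m)) (trans (!-twice-odd R₁ i) (!-range 1 refl i<m))

  L₁-b : ∀ {k} → k < E → L₁ ! (2 * m + 2 * k) ≡ suc m + k × L₁ ! (2 * m + suc (2 * k)) ≡ suc m + k
  L₁-b {k} k<E =
    trans (!-second-block (twice R₁) length-twice-R₁ (2 * k))
      (trans (!-++ˡ (twice S₁) (subst (2 * k <_) (sym length-twice-S₁) (double-< k<E)))
        (trans (!-twice-even S₁ k) (!-range (suc m) a≡1+m+E k<E))) ,
    trans (!-second-block (twice R₁) length-twice-R₁ (suc (2 * k)))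
      (trans (!-++ˡ (twice S₁) (subst (suc (2 * k) <_) (sym length-twice-S₁) (double-suc-< k<E)))
        (trans (!-twice-odd S₁ k) (!-range (suc m) a≡1+m+E k<E)))

  L₁-ℓ : L₁ ! (2 * m + 2 * E) ≡ a
  L₁-ℓ = trans (!-second-block (twice R₁) length-twice-R₁ (2 * E)) (!-++-∷ (twice S₁) length-twice-S₁)

  L₂-a₀ : ∀ {i} → i < m → L₂ ! (2 * i) ≡ suc i
  L₂-a₀ {i} i<m =
    trans (!-first-block X₂ length-X₂ (double-< i<m))
      (trans (!-++ˡ (1 ∷ twice R₂) (s≤s (subst (2 * i ≤_) (sym length-twice-R₂) (ℕ.*-monoʳ-≤ 2 (ℕ.≤-pred i<m)))))
        (trans (!-∷-twice 1 R₂ i) (head-or-R₂ i i<m)))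
    where
    head-or-R₂ : ∀ i → i < m → (1 ∷ R₂) ! i ≡ suc i
    head-or-R₂ zero _ = refl
    head-or-R₂ (suc i) (s≤s i<) = !-range 2 refl i<

  L₂-a₁ : ∀ {i} → i < suc n → L₂ ! suc (2 * i) ≡ suc (suc i)
  L₂-a₁ {i} i< =
    trans (!-first-block X₂ length-X₂ (double-suc-< (ℕ.m<n⇒m<1+n i<)))
      (trans (!-++ˡ (twice R₂) (subst (2 * i <_) (sym length-twice-R₂) (double-< i<)))
        (trans (!-twice-even R₂ i) (!-range 2 refl i<)))

  L₂-wrap : L₂ ! suc (2 * suc n) ≡ 1
  L₂-wrap = trans (!-first-block X₂ length-X₂ (double-suc-< (ℕ.n<1+n (suc n)))) (!-++-∷ (twice R₂) length-twice-R₂)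

  L₂-b : ∀ {q} → q < 2 * E → L₂ ! (2 * m + q) ≡ suc m + q
  L₂-b {q} q< =
    trans (!-second-block X₂ length-X₂ q) (trans (!-++ˡ S₂ (subst (q <_) (sym length-S₂) q<)) (!-range (suc m) b≡1+m+2E q<))

  L₂-ℓ : L₂ ! (2 * m + 2 * E) ≡ suc m
  L₂-ℓ = trans (!-second-block X₂ length-X₂ (2 * E)) (!-++-∷ S₂ length-S₂)

  L₃-a : ∀ {p} → p < 2 * m → L₃ ! p ≡ suc p
  L₃-a p< = trans (!-first-block R₃ length-R₃ p<) (!-range 1 refl p<)

  L₃-even : ∀ {k} → k ≤ E → L₃ ! (2 * m + 2 * k) ≡ z + k
  L₃-even {k} k≤E = trans (!-second-block R₃ length-R₃ (2 * k)) (trans (!-∷-twice z S₃ k) (head-or-S₃ k k≤E))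
    where
    head-or-S₃ : ∀ k → k ≤ E → (z ∷ S₃) ! k ≡ z + k
    head-or-S₃ zero _ = sym (ℕ.+-identityʳ z)
    head-or-S₃ (suc k) k< = trans (!-range (z + 1) c≡z+1+E k<) (ℕ.+-assoc z 1 k)

  L₃-odd : ∀ {k} → k < E → L₃ ! (2 * m + suc (2 * k)) ≡ z + suc k
  L₃-odd {k} k<E =
    trans (!-second-block R₃ length-R₃ (suc (2 * k)))
      (trans (!-twice-even S₃ k) (trans (!-range (z + 1) c≡z+1+E k<E) (ℕ.+-assoc z 1 k)))

  pos : Question → ℕ
  pos (a₀ i) = 2 * toℕ i
  pos (a₁ j) = suc (2 * toℕ (prev j))
  pos (b₀ k) = 2 * m + 2 * toℕ k
  pos (b₁ k) = 2 * m + suc (2 * toℕ k)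
  pos ℓ = 2 * m + 2 * E

  L₁-at-pos : ∀ t → L₁ ! pos t ≡ encU (qu t)
  L₁-at-pos (a₀ i) = trans (proj₁ (L₁-a (Fin.toℕ<n i))) (sym (encU-ua i))
  L₁-at-pos (a₁ j) = trans (proj₂ (L₁-a (Fin.toℕ<n (prev j)))) (sym (encU-ua (prev j)))
  L₁-at-pos (b₀ k) = trans (proj₁ (L₁-b (Fin.toℕ<n k))) (sym (encU-ub k))
  L₁-at-pos (b₁ k) = trans (proj₂ (L₁-b (Fin.toℕ<n k))) (sym (encU-ub k))
  L₁-at-pos ℓ = trans L₁-ℓ (sym encU-ul)

  L₂-at-pos : ∀ t → L₂ ! pos t ≡ encV (qv t)
  L₂-at-pos (a₀ i) = trans (L₂-a₀ (Fin.toℕ<n i)) (sym (encV-va i))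
  L₂-at-pos (a₁ zero) =
    trans (cong (λ x → L₂ ! suc (2 * x)) (Fin.toℕ-fromℕ (suc n))) (trans L₂-wrap (sym (encV-va zero)))
  L₂-at-pos (a₁ (suc j)) =
    trans (cong (λ x → L₂ ! suc (2 * x)) (Fin.toℕ-inject₁ j)) (trans (L₂-a₁ (Fin.toℕ<n j)) (sym (encV-va (suc j))))
  L₂-at-pos (b₀ k) = trans (L₂-b (double-< (Fin.toℕ<n k))) (sym (encV-vb-false k))
  L₂-at-pos (b₁ k) = trans (L₂-b (double-suc-< (Fin.toℕ<n k))) (sym (encV-vb-true k))
  L₂-at-pos ℓ = trans L₂-ℓ (sym (trans (encV-vb-false zero) (ℕ.+-identityʳ (suc m))))

  L₃-at-pos : ∀ t → L₃ ! pos t ≡ encW (qw t)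
  L₃-at-pos (a₀ i) = trans (L₃-a (double-< (Fin.toℕ<n i))) (sym (encW-wa-false i))
  L₃-at-pos (a₁ j) = trans (L₃-a (double-suc-< (Fin.toℕ<n (prev j)))) (sym (encW-wa-true (prev j)))
  L₃-at-pos (b₀ k) =
    trans (L₃-even (ℕ.<⇒≤ (Fin.toℕ<n k))) (sym (trans (encW-wb (inject₁ k)) (cong (z +_) (Fin.toℕ-inject₁ k))))
  L₃-at-pos (b₁ k) = trans (L₃-odd (Fin.toℕ<n k)) (sym (encW-wb (suc k)))
  L₃-at-pos ℓ = trans (L₃-even ℕ.≤-refl) (sym (trans (encW-wb (fromℕ (suc e))) (cong (z +_) (Fin.toℕ-fromℕ (suc e)))))

  N : ℕ
  N = 2 * m + suc (2 * E)

  private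
    second-block-length : ∀ {L} → L ≡ 2 * E → L + 1 ≡ suc (2 * E)
    second-block-length refl = ℕ.+-comm (2 * E) 1

  length-L₁ : length L₁ ≡ N
  length-L₁ = trans (length-++ (twice R₁))
    (cong₂ _+_ length-twice-R₁ (trans (length-++ (twice S₁)) (second-block-length length-twice-S₁)))

  length-L₂ : length L₂ ≡ N
  length-L₂ = trans (length-++ X₂) (cong₂ _+_ length-X₂ (trans (length-++ S₂) (second-block-length length-S₂)))

  length-L₃ : length L₃ ≡ N
  length-L₃ = trans (length-++ R₃) (cong₂ _+_ length-R₃ (cong suc length-twice-S₃))

  pos<N : ∀ t → pos t < N
  pos<N (a₀ i) = ℕ.<-≤-trans (double-< (Fin.toℕ<n i)) (ℕ.m≤m+n (2 * m) _)
  pos<N (a₁ j) = ℕ.<-≤-trans (double-suc-< (Fin.toℕ<n (prev j))) (ℕ.m≤m+n (2 * m) _)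
  pos<N (b₀ k) = ℕ.+-monoʳ-< (2 * m) (ℕ.m<n⇒m<1+n (double-< (Fin.toℕ<n k)))
  pos<N (b₁ k) = ℕ.+-monoʳ-< (2 * m) (ℕ.m<n⇒m<1+n (double-suc-< (Fin.toℕ<n k)))
  pos<N ℓ = ℕ.+-monoʳ-< (2 * m) (ℕ.n<1+n (2 * E))

  questions≡ : questions a b c ≡ zipWith _,_ L₁ (zipWith _,_ L₂ L₃)
  questions≡ = cong₂ (zipWith _,_) list₁≡L₁ (cong₂ (zipWith _,_) list₂≡L₂ list₃≡L₃)

  encQ : Question → Triple
  encQ t = encU (qu t) , encV (qv t) , encW (qw t)

  listed : ∀ t → encQ t ∈ questions a b c
  listed t = subst (encQ t ∈_) (sym questions≡)
    (subst (_∈ zipWith _,_ L₁ (zipWith _,_ L₂ L₃)) (cong₂ _,_ (L₁-at-pos t) (cong₂ _,_ (L₂-at-pos t) (L₃-at-pos t)))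
      (∈-zip₃ L₁ L₂ L₃ (below L₁ length-L₁) (below L₂ length-L₂) (below L₃ length-L₃)))
    where
    below : ∀ xs → length xs ≡ N → pos t < length xs
    below _ len = subst (pos t <_) (sym len) (pos<N t)

  private
    z≤c : z ≤ c
    z≤c = ℕ.≤-trans (ℕ.m≤m+n z (suc E)) (ℕ.≤-reflexive (sym (regroup m E)))
      where
      regroup : ∀ m E → m * 2 + (suc E + 1) ≡ suc (2 * m) + suc E
      regroup = solve-∀

    1+m≤b : suc m ≤ b
    1+m≤b = ℕ.≤-trans (ℕ.≤-reflexive (ℕ.+-comm 1 m)) (ℕ.+-monoʳ-≤ m (s≤s z≤n))

  L₁-in-range : All (InRange a) L₁
  L₁-in-range =
    All.++⁺ (all-twice (all-in-range 1 m ℕ.≤-refl (ℕ.m≤m+n m _)))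
      (All.++⁺ (all-twice (all-in-range (suc m) (a ∸ 1) (s≤s z≤n) (ℕ.m∸n≤m a 1))) ((s≤s z≤n , ℕ.≤-refl) ∷ []))

  L₂-in-range : All (InRange b) L₂
  L₂-in-range =
    All.++⁺ (one ∷ All.++⁺ (all-twice (all-in-range 2 m (s≤s z≤n) (ℕ.m≤m+n m _))) (one ∷ []))
      (All.++⁺ (all-in-range (suc m) (b ∸ 1) (s≤s z≤n) (ℕ.m∸n≤m b 1)) ((s≤s z≤n , 1+m≤b) ∷ []))
    where
    one : InRange b 1
    one = ℕ.≤-refl , s≤s z≤n

  L₃-in-range : All (InRange c) L₃
  L₃-in-range =
    All.++⁺ (all-in-range 1 (2 * m) ℕ.≤-refl (ℕ.≤-trans (ℕ.n≤1+n _) z≤c))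
      ((s≤s z≤n , z≤c) ∷ all-twice (all-in-range (z + 1) (c ∸ 1) (s≤s z≤n) (ℕ.m∸n≤m c 1)))

  encS : Secret → Triple
  encS (u , v , w) = encU u , encV v , encW w

  decode : ∀ {s} → InBox a b c s → ∃ λ σ → encS σ ≡ s
  decode ((1≤x , x≤a) , (1≤y , y≤b) , (1≤z , z≤c))
    with encU-onto 1≤x x≤a | encV-onto 1≤y y≤b | encW-onto 1≤z z≤c
  ... | u , refl | v , refl | w , refl = (u , v , w) , refl

  g≡answer : ∀ σ t → g (encS σ) (encQ t) ≡ answer σ t
  g≡answer (u , v , w) t = cong₂ _+_ (cong₂ _+_ (δ-encU _≟U_ u (qu t)) (δ-encV _≟V_ v (qv t))) (δ-encW _≟W_ w (qw t))

  feasible : FeasibleStrategy a b c (questions a b c)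
  feasible =
    subst (IsStrategy a b c) (sym questions≡) (is-strategy-if-in-range L₁-in-range L₂-in-range L₃-in-range) ,
    distinguishes-via-encoding answer encS encQ decode g≡answer listed
      (answers-injective qu-onto qv-onto qw-onto uv-separated uw-separated vw-separated no-confusion)

5≤2d∸1⇒d≡3+n : ∀ d → 5 ≤ 2 * d ∸ 1 → ∃ λ n → d ≡ 3 + n
5≤2d∸1⇒d≡3+n 0 ()
5≤2d∸1⇒d≡3+n 1 (s≤s ())
5≤2d∸1⇒d≡3+n 2 (s≤s (s≤s (s≤s ())))
5≤2d∸1⇒d≡3+n (suc (suc (suc n))) _ = n , refl

private
  a-shape : ∀ a e n → 3 * a ≡ (suc a + e) + (a + (3 + n)) → a ≡ (2 + n) + (suc e + 1)
  a-shape a e n 3a≡b+c = ℕ.+-cancelˡ-≡ (a + a) _ _ (trans (lhs a) (trans 3a≡b+c (rhs a e n)))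
    where
    lhs : ∀ a → a + a + a ≡ 3 * a
    lhs = solve-∀
    rhs : ∀ a e n → (suc a + e) + (a + (3 + n)) ≡ a + a + ((2 + n) + (suc e + 1))
    rhs = solve-∀

  b-shape : ∀ n e → suc ((2 + n) + (suc e + 1)) + e ≡ (2 + n) + (suc e * 2 + 1)
  b-shape = solve-∀

  c-shape : ∀ n e → (2 + n) + (suc e + 1) + (3 + n) ≡ (2 + n) * 2 + (suc (suc e) + 1)
  c-shape = solve-∀

parametrise : ∀ {a b c} → a ≤ c → 3 * a ≡ b + c → a < b → 5 ≤ zOf a c →
  ∃ λ n → ∃ λ e → a ≡ Numbering.a n e × b ≡ Numbering.b n e × c ≡ Numbering.c n e
parametrise {a} a≤c 3a≡b+c a<b 5≤z with ℕ.m≤n⇒∃[o]m+o≡n a<b | ℕ.m≤n⇒∃[o]m+o≡n a≤c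
... | e , refl | d , refl with 5≤2d∸1⇒d≡3+n d (subst (λ x → 5 ≤ 2 * x ∸ 1) (ℕ.m+n∸m≡n a d) 5≤z)
...   | n , refl with a-shape a e n 3a≡b+c
...     | refl = n , e , refl , b-shape n e , c-shape n e

lemma8 : (a b c : ℕ) → a ≤ b → b ≤ c → 3 * a ≡ b + c → a < b → 5 ≤ zOf a c →
         FeasibleStrategy a b c (questions a b c)
lemma8 a b c a≤b b≤c 3a≡b+c a<b 5≤z with parametrise (ℕ.≤-trans a≤b b≤c) 3a≡b+c a<b 5≤z
... | n , e , refl , refl , refl = Numbering.feasible n e
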